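{- Let $M$ be an ordered matroid on $E$, let $F\subseteq E$ be a spanning set of $M$ (i.e. $F$ contains a base of $M$), and let $K=M|F$ with the induced order. Then $\mathcal B(K)\subseteq\mathcal B(M)$, and for all $A,B\in\mathcal B(K)$ we have $A\le_K B$ if and only if $A\le_M B$. Consequently the inclusion $\mathcal B(K)\subseteq\mathcal B(M)$ (with $\hat0\mapsto\hat0$) induces an inclusion of posets $L(K)\subseteq L(M)$.
   Context: An ordered matroid is a matroid on a finite set $E$ together with a linear order on $E$; $\mathcal B(N)$ is the set of bases of a matroid $N$. For an ordered matroid $N$ and a subset $F$ of its ground set, an element $e$ is active with respect to $F$ if there is a circuit $C\subseteq F\cup\{e\}$ with $e\in C$ and $e$ the minimum of $C$; $\mathrm{Act}_N(F)$ is the set of such $e$ (possibly $e\in F$), and $\mathrm{Ext}_N(F)=\mathrm{Act}_N(F)\setminus F$. The external order on $\mathcal B(N)$ is $A\le_N B$ iff $A\subseteq B\cup\mathrm{Ext}_N(B)$, and $L(N)$ is $\mathcal B(N)$ with this order and a new minimum $\hat0$ adjoined (a lattice). -}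

module Defs where

open import Data.Nat using (ℕ; _<_; _≤_)
open import Data.Fin using (Fin; toℕ)
open import Data.Fin.Subset using (Subset; _∈_; _∉_; _⊆_; _∪_; ⁅_⁆; ∣_∣; ⊥)
open import Data.Fin.Subset.Properties using (⊆-trans; x∈p∪q⁻; x∈⁅y⁆⇒x≡y; ∉⊥)
open import Data.Product using (Σ; ∃; _×_; _,_; proj₁; proj₂)
open import Data.Sum using (_⊎_; inj₁; inj₂)
open import Data.Maybe using (Maybe; just; nothing)
open import Data.Empty using (⊥-elim)
open import Relation.Nullary using (¬_)
open import Relation.Binary.PropositionalEquality using (_≡_; refl; subst; sym)

-- Ordered matroid:
-- the linear order on the ground set is the order of Fin n (via toℕ),
-- restricted to E.
record Matroid (n : ℕ) : Set₁ where
  field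
    E       : Subset n
    Indep   : Subset n → Set
    indep⊆E : ∀ {I} → Indep I → I ⊆ E
    indep-∅ : Indep ⊥
    indep-↓ : ∀ {I J} → Indep J → I ⊆ J → Indep I
    indep-aug : ∀ {I J} → Indep I → Indep J → ∣ I ∣ < ∣ J ∣ →
                ∃ λ x → x ∈ J × x ∉ I × Indep (I ∪ ⁅ x ⁆)

open Matroid public

module _ {n : ℕ} (N : Matroid n) where

  IsBase : Subset n → Set
  IsBase B = Indep N B × (∀ I → Indep N I → B ⊆ I → I ≡ B)

  IsCircuit : Subset n → Set
  IsCircuit C = C ⊆ E N × ¬ Indep N C × (∀ D → D ⊆ C → ¬ Indep N D → D ≡ C)

  Act : Subset n → Fin n → Set
  Act F e = e ∈ E N × (∃ λ C → IsCircuit C × C ⊆ (F ∪ ⁅ e ⁆) × e ∈ C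
                                × (∀ {c} → c ∈ C → toℕ e ≤ toℕ c))

  Ext : Subset n → Fin n → Set
  Ext F e = Act F e × e ∉ F

  _≤Ext_ : Subset n → Subset n → Set
  A ≤Ext B = ∀ {x} → x ∈ A → x ∈ B ⊎ Ext B x

  -- L(N): bases of N with a new minimum 0̂ (= nothing)
  L : Set
  L = Maybe (Σ (Subset n) IsBase)

  _≤L_ : L → L → Set
  nothing ≤L y = Data.Unit.⊤
    where import Data.Unit
  just x ≤L nothing = Data.Empty.⊥
    where import Data.Empty
  just (A , _) ≤L just (B , _) = A ≤Ext B

  Spanning : Subset n → Set
  Spanning F = F ⊆ E N × ∃ λ B → IsBase B × B ⊆ F

restrict : ∀ {n} (M : Matroid n) (F : Subset n) → F ⊆ E M → Matroid n
restrict M F F⊆E = record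
  { E = F
  ; Indep = λ I → Indep M I × I ⊆ F
  ; indep⊆E = proj₂
  ; indep-∅ = indep-∅ M , λ x∈⊥ → ⊥-elim (∉⊥ x∈⊥)
  ; indep-↓ = λ (j , j⊆F) I⊆J → indep-↓ M j I⊆J , ⊆-trans I⊆J j⊆F
  ; indep-aug = aug
  }
  where
  aug : ∀ {I J} → Indep M I × I ⊆ F → Indep M J × J ⊆ F → ∣ I ∣ < ∣ J ∣ →
        ∃ λ x → x ∈ J × x ∉ I × (Indep M (I ∪ ⁅ x ⁆) × (I ∪ ⁅ x ⁆) ⊆ F)
  aug {I} {J} (i , I⊆F) (j , J⊆F) lt with indep-aug M i j lt
  ... | x , x∈J , x∉I , ix = x , x∈J , x∉I , ix , sub
    where
    sub : (I ∪ ⁅ x ⁆) ⊆ F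
    sub {y} y∈ with x∈p∪q⁻ I ⁅ x ⁆ y∈
    ... | inj₁ y∈I = I⊆F y∈I
    ... | inj₂ y∈x = subst (_∈ F) (sym (x∈⁅y⁆⇒x≡y x y∈x)) (J⊆F x∈J)

{-# OPTIONS --safe #-}
module Submission where

-- A base of M|F is M-independent, and it is at least as large as a base of M
-- contained in F (which is M|F-independent); an M-independent set that large
-- is a base of M.  The circuits of M|F are exactly the circuits of M inside F,
-- and a circuit witnessing that e is active for B lies in B ∪ {e}, which is
-- inside F whenever B ⊆ F and e ∈ F; so the two external orders agree on
-- subsets of F, in particular on the bases of M|F.

open import Defs
open import Data.Nat using (ℕ; _≤_)
open import Data.Nat.Properties using (≤-trans; ≮⇒≥; <⇒≱)
open import Data.Fin using (Fin)
open import Data.Fin.Subset using (Subset; _∈_; _∉_; _⊆_; _∪_; ⁅_⁆; ∣_∣)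
open import Data.Fin.Subset.Properties
  using (_∈?_; ⊆-trans; ⊆-antisym; x∈p∪q⁻; x∈⁅x⁆; x∈⁅y⁆⇒x≡y; p⊆p∪q; q⊆p∪q; p⊂q⇒∣p∣<∣q∣)
open import Data.Product using (Σ; ∃; _×_; _,_; proj₁; map₁; map₂)
import Data.Sum as Sum
import Data.Maybe as Maybe
open import Data.Maybe using (just; nothing)
open import Data.Empty using (⊥-elim)
open import Data.Unit using (tt)
open import Function using (id)
open import Relation.Nullary using (¬_; yes; no)
open import Function.Bundles using (_⇔_; mk⇔)
open import Relation.Binary.PropositionalEquality using (_≡_; refl; subst; sym)

module _ {n : ℕ} where

  p⊆q∧∣q∣≤∣p∣⇒q≡p : {p q : Subset n} → p ⊆ q → ∣ q ∣ ≤ ∣ p ∣ → q ≡ p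
  p⊆q∧∣q∣≤∣p∣⇒q≡p {p} {q} p⊆q ∣q∣≤∣p∣ = ⊆-antisym q⊆p p⊆q
    where
    q⊆p : q ⊆ p
    q⊆p {x} x∈q with x ∈? p
    ... | yes x∈p = x∈p
    ... | no  x∉p = ⊥-elim (<⇒≱ (p⊂q⇒∣p∣<∣q∣ (p⊆q , x , x∈q , x∉p)) ∣q∣≤∣p∣)

  p∪⁅x⁆⊆q : {p q : Subset n} {x : Fin n} → p ⊆ q → x ∈ q → p ∪ ⁅ x ⁆ ⊆ q
  p∪⁅x⁆⊆q {p} {x = x} p⊆q x∈q y∈p∪⁅x⁆ =
    Sum.[ p⊆q , (λ y∈⁅x⁆ → subst (_∈ _) (sym (x∈⁅y⁆⇒x≡y x y∈⁅x⁆)) x∈q) ] (x∈p∪q⁻ p ⁅ x ⁆ y∈p∪⁅x⁆)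

module _ {n : ℕ} (N : Matroid n) where

  base∪⁅x⁆-dependent : ∀ {B x} → IsBase N B → x ∉ B → ¬ Indep N (B ∪ ⁅ x ⁆)
  base∪⁅x⁆-dependent {B} {x} (_ , maximal) x∉B indep =
    x∉B (subst (x ∈_) (maximal _ indep (p⊆p∪q ⁅ x ⁆)) (q⊆p∪q B ⁅ x ⁆ (x∈⁅x⁆ x)))

  ∣indep∣≤∣base∣ : ∀ {B I} → IsBase N B → Indep N I → ∣ I ∣ ≤ ∣ B ∣
  ∣indep∣≤∣base∣ base@(indepB , _) indepI = ≮⇒≥ λ ∣B∣<∣I∣ →
    let (x , _ , x∉B , indep) = indep-aug N indepB indepI ∣B∣<∣I∣
    in base∪⁅x⁆-dependent base x∉B indep

  indep∧∣base∣≤⇒base : ∀ {B₀ B} → IsBase N B₀ → Indep N B → ∣ B₀ ∣ ≤ ∣ B ∣ → IsBase N B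
  indep∧∣base∣≤⇒base base₀ indepB ∣B₀∣≤∣B∣ = indepB , λ I indepI B⊆I →
    p⊆q∧∣q∣≤∣p∣⇒q≡p B⊆I (≤-trans (∣indep∣≤∣base∣ base₀ indepI) ∣B₀∣≤∣B∣)

module _ {n : ℕ} (M : Matroid n) (F : Subset n) (F⊆E : F ⊆ E M) where

  private
    K : Matroid n
    K = restrict M F F⊆E

  circuit-restrict⇒circuit : ∀ {C} → IsCircuit K C → IsCircuit M C
  circuit-restrict⇒circuit (C⊆F , dependent , minimal) =
    ⊆-trans C⊆F F⊆E , (λ indep → dependent (indep , C⊆F)) ,
    λ D D⊆C D-dependent → minimal D D⊆C (λ indep → D-dependent (proj₁ indep))

  circuit⇒circuit-restrict : ∀ {C} → C ⊆ F → IsCircuit M C → IsCircuit K C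
  circuit⇒circuit-restrict C⊆F (_ , dependent , minimal) =
    C⊆F , (λ indep → dependent (proj₁ indep)) ,
    λ D D⊆C D-dependent → minimal D D⊆C (λ indep → D-dependent (indep , ⊆-trans D⊆C C⊆F))

  Act-restrict⇒Act : ∀ {B x} → Act K B x → Act M B x
  Act-restrict⇒Act (x∈F , C , circuit , rest) =
    F⊆E x∈F , C , circuit-restrict⇒circuit circuit , rest

  Act⇒Act-restrict : ∀ {B x} → B ⊆ F → x ∈ F → Act M B x → Act K B x
  Act⇒Act-restrict B⊆F x∈F (_ , C , circuit , C⊆B∪⁅x⁆ , rest) =
    x∈F , C , circuit⇒circuit-restrict (⊆-trans C⊆B∪⁅x⁆ (p∪⁅x⁆⊆q B⊆F x∈F)) circuit ,
    C⊆B∪⁅x⁆ , rest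

  ≤Ext-restrict⇔ : ∀ {A B} → A ⊆ F → B ⊆ F → (_≤Ext_ K A B ⇔ _≤Ext_ M A B)
  ≤Ext-restrict⇔ A⊆F B⊆F = mk⇔
    (λ A≤B {x} x∈A → Sum.map₂ (map₁ (Act-restrict⇒Act {x = x})) (A≤B x∈A))
    (λ A≤B {x} x∈A → Sum.map₂ (map₁ (Act⇒Act-restrict B⊆F (A⊆F x∈A))) (A≤B x∈A))

  base-restrict⇒base : (∃ λ B₀ → IsBase M B₀ × B₀ ⊆ F) → ∀ {B} → IsBase K B → IsBase M B
  base-restrict⇒base (B₀ , base₀@(indepB₀ , _) , B₀⊆F) base@((indepB , _) , _) =
    indep∧∣base∣≤⇒base M base₀ indepB (∣indep∣≤∣base∣ K base (indepB₀ , B₀⊆F))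

module _ {n : ℕ} (N N′ : Matroid n) (base⇒base : ∀ {B} → IsBase N B → IsBase N′ B) where

  L-map : L N → L N′
  L-map = Maybe.map (map₂ base⇒base)

  L-map-≤L⇔ : (∀ {A B} → IsBase N A → IsBase N B → (_≤Ext_ N A B ⇔ _≤Ext_ N′ A B)) →
              ∀ x y → (_≤L_ N x y ⇔ _≤L_ N′ (L-map x) (L-map y))
  L-map-≤L⇔ ≤Ext⇔ nothing            y                  = mk⇔ (λ _ → tt) (λ _ → tt)
  L-map-≤L⇔ ≤Ext⇔ (just _)           nothing            = mk⇔ id id
  L-map-≤L⇔ ≤Ext⇔ (just (_ , baseA)) (just (_ , baseB)) = ≤Ext⇔ baseA baseB

corollary2p2 : ∀ {n} (M : Matroid n) (F : Subset n) (sp : Spanning M F) →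
    let K = restrict M F (Σ.proj₁ sp) in
    (∀ B → IsBase K B → IsBase M B)
    × (∀ A B → IsBase K A → IsBase K B → (_≤Ext_ K A B ⇔ _≤Ext_ M A B))
    × (Σ (L K → L M) λ ι →
        (ι nothing ≡ nothing)
        × (∀ B (p : IsBase K B) → ∃ λ q → ι (just (B , p)) ≡ just (B , q))
        × (∀ x y → (_≤L_ K x y ⇔ _≤L_ M (ι x) (ι y))))
corollary2p2 {n} M F (F⊆E , spanning-base) =
  (λ _ → base⇒base) , (λ _ _ → bases-≤Ext⇔) ,
  ι , refl , (λ _ base → base⇒base base , refl) , L-map-≤L⇔ K M base⇒base bases-≤Ext⇔
  where
  K : Matroid n
  K = restrict M F F⊆E

  base⇒base : ∀ {B} → IsBase K B → IsBase M B
  base⇒base = base-restrict⇒base M F F⊆E spanning-base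

  ι : L K → L M
  ι = L-map K M base⇒base

  bases-≤Ext⇔ : ∀ {A B} → IsBase K A → IsBase K B → (_≤Ext_ K A B ⇔ _≤Ext_ M A B)
  bases-≤Ext⇔ (indepA , _) (indepB , _) =
    ≤Ext-restrict⇔ M F F⊆E (indep⊆E K indepA) (indep⊆E K indepB)
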